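{- Let $T$ be a rooted binary tree and let $t\geq 1$ be an integer. Assume that no root-leaf path in $T$ contains a sub-sequence $a_1,\ldots,a_t$ of pairwise distinct vertices such that $a_j$ is a right descendant of $a_i$ for all $1\leq i<j\leq t$. If $T$ has height at most $h$, then $T$ has at most $h^{t+1}$ vertices.
   Context: In a rooted binary tree each non-root vertex is marked as a left or a right successor of its predecessor. A vertex $w$ is a right (left) descendant of $v$ if the first vertex after $v$ on the unique $v$-$w$ path in $T$ is a right (left) successor of $v$. -}

module Defs where

open import Data.Nat using (ℕ; zero; suc; _+_; _⊔_)
open import Data.Maybe using (Maybe; just; nothing)
open import Data.List using (List; []; _∷_; _++_)
open import Data.Product using (Σ; ∃; _×_; _,_)
open import Data.Fin using (Fin; _<_)
open import Relation.Binary.PropositionalEquality using (_≡_; _≢_)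
open import Relation.Nullary using (¬_)

data BTree : Set where
  node : Maybe BTree → Maybe BTree → BTree

data Dir : Set where
  L R : Dir

-- Vertices are identified with their addresses: the list of steps from the root.
Addr : Set
Addr = List Dir

data InTree : BTree → Addr → Set where
  here  : ∀ {l r} → InTree (node l r) []
  left  : ∀ {l r v} → InTree l v → InTree (node (just l) r) (L ∷ v)
  right : ∀ {l r v} → InTree r v → InTree (node l (just r)) (R ∷ v)

IsLeaf : BTree → Addr → Set
IsLeaf T v = InTree T v × ¬ InTree T (v ++ (L ∷ [])) × ¬ InTree T (v ++ (R ∷ []))

OnPath : Addr → Addr → Set
OnPath v p = ∃ λ s → v ++ s ≡ p

RightDesc : Addr → Addr → Set
RightDesc w v = ∃ λ s → w ≡ v ++ (R ∷ s)

HasRightChain : ℕ → Addr → Set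
HasRightChain t p =
  Σ (Fin t → Addr) λ a →
    (∀ i → OnPath (a i) p) ×
    (∀ i j → i ≢ j → a i ≢ a j) ×
    (∀ i j → i < j → RightDesc (a j) (a i))

msize : Maybe BTree → ℕ
size : BTree → ℕ
msize nothing = 0
msize (just T) = size T
size (node l r) = suc (msize l + msize r)

-- height = number of vertices on a longest root-leaf path
mheight : Maybe BTree → ℕ
height : BTree → ℕ
mheight nothing = 0
mheight (just T) = height T
height (node l r) = suc (mheight l ⊔ mheight r)

module Submission where

-- Call T "t-free" if no root-leaf path of T carries a right
-- chain of length t.  We prove the sharper bound
--     T is t-free, t ≥ 1, height T ≤ h   ⟹   size T ≤ h ^ t
-- by induction on t and on T, and weaken h ^ t ≤ h ^ (t+1) at the end.
--   * t = 1: no tree is 1-free, since every tree has a leaf and any single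
--     vertex of a path is a right chain of length 1.
--   * t ≥ 2, T = node l r: the left subtree is again t-free, because a chain
--     in l stays a chain in T after prepending the step L; the right subtree
--     is (t-1)-free, because a chain in r, shifted under R and preceded by
--     the root, is a chain of length t in T.  With height ≤ h-1 below the root,
--         size T ≤ 1 + (h-1)^t + (h-1)^(t-1) ≤ h^t.

open import Defs
open import Data.Nat using (ℕ; zero; suc; _≤_; _^_; _+_; _*_; z≤n; s≤s)
open import Data.Nat.Properties
open import Relation.Nullary using (¬_; contradiction)
open import Data.Maybe using (just; nothing)
open import Data.List using ([]; _∷_)
open import Data.List.Properties using (++-identityʳ; ∷-injectiveʳ)
open import Data.Product using (Σ; _,_; proj₁; proj₂)
open import Data.Fin using (Fin; _<_) renaming (zero to fzero; suc to fsuc)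
open import Relation.Binary.PropositionalEquality using (_≡_; refl; cong)

leafUnderLeft : ∀ {l r p} → IsLeaf l p → IsLeaf (node (just l) r) (L ∷ p)
leafUnderLeft (inT , noL , noR) =
  left inT , (λ { (left x) → noL x }) , (λ { (left x) → noR x })

leafUnderRight : ∀ {l r p} → IsLeaf r p → IsLeaf (node l (just r)) (R ∷ p)
leafUnderRight (inT , noL , noR) =
  right inT , (λ { (right x) → noL x }) , (λ { (right x) → noR x })

leafExists : (T : BTree) → Σ Addr (IsLeaf T)
leafExists (node nothing nothing) = [] , here , (λ ()) , (λ ())
leafExists (node (just l) r) with leafExists l
... | p , leaf = L ∷ p , leafUnderLeft leaf
leafExists (node nothing (just r)) with leafExists r
... | p , leaf = R ∷ p , leafUnderRight leaf

trivialChain : ∀ p → HasRightChain 1 p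
trivialChain p =
  (λ _ → p) , (λ _ → [] , ++-identityʳ p)
  , (λ { fzero fzero ne _ → ne refl }) , (λ { fzero fzero () })

shiftChain : ∀ {t p} d → HasRightChain t p → HasRightChain t (d ∷ p)
shiftChain d (a , onPath , distinct , rightDesc) =
  (λ i → d ∷ a i)
  , (λ i → let (s , eq) = onPath i in s , cong (d ∷_) eq)
  , (λ i j i≢j eq → distinct i j i≢j (∷-injectiveʳ eq))
  , (λ i j i<j → let (s , eq) = rightDesc i j i<j in s , cong (d ∷_) eq)

-- A right chain below the right successor of the root, preceded by the root
-- itself, is a right chain one longer: every shifted vertex starts with R.
extendAtRoot : ∀ {t p} → HasRightChain t p → HasRightChain (suc t) (R ∷ p)
extendAtRoot {t} {p} chain@(a , _) = a′ , onPath′ , distinct′ , rightDesc′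
  where
  onPathᴿ : ∀ i → OnPath (R ∷ a i) (R ∷ p)
  onPathᴿ = proj₁ (proj₂ (shiftChain R chain))
  distinctᴿ : ∀ i j → ¬ i ≡ j → ¬ R ∷ a i ≡ R ∷ a j
  distinctᴿ = proj₁ (proj₂ (proj₂ (shiftChain R chain)))
  rightDescᴿ : ∀ i j → i < j → RightDesc (R ∷ a j) (R ∷ a i)
  rightDescᴿ = proj₂ (proj₂ (proj₂ (shiftChain R chain)))
  a′ : Fin (suc t) → Addr
  a′ fzero    = []
  a′ (fsuc i) = R ∷ a i
  onPath′ : ∀ i → OnPath (a′ i) (R ∷ p)
  onPath′ fzero    = R ∷ p , refl
  onPath′ (fsuc i) = onPathᴿ i
  distinct′ : ∀ i j → ¬ i ≡ j → ¬ a′ i ≡ a′ j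
  distinct′ fzero    fzero    i≢j _  = i≢j refl
  distinct′ fzero    (fsuc j) _   ()
  distinct′ (fsuc i) fzero    _   ()
  distinct′ (fsuc i) (fsuc j) i≢j =
    distinctᴿ i j (λ i≡j → i≢j (cong fsuc i≡j))
  rightDesc′ : ∀ i j → i < j → RightDesc (a′ j) (a′ i)
  rightDesc′ fzero    (fsuc j) _         = a j , refl
  rightDesc′ (fsuc i) (fsuc j) (s≤s i<j) =
    rightDescᴿ i j i<j

RightChainFree : ℕ → BTree → Set
RightChainFree t T = ∀ p → IsLeaf T p → ¬ HasRightChain t p

notOneFree : ∀ T → ¬ RightChainFree 1 T
notOneFree T free with leafExists T
... | p , leaf = free p leaf (trivialChain p)

leftFree : ∀ {t l r} → RightChainFree t (node (just l) r) → RightChainFree t l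
leftFree free p leaf chain = free (L ∷ p) (leafUnderLeft leaf) (shiftChain L chain)

rightFree : ∀ {t l r} → RightChainFree (suc t) (node l (just r)) → RightChainFree t r
rightFree free p leaf chain = free (R ∷ p) (leafUnderRight leaf) (extendAtRoot chain)

-- a^(n+1) + 1 ≤ (a+1)^(n+1): expand (a+1)^(n+1) = (a+1)^n + a·(a+1)^n.
powerPlusOne≤ : ∀ a n → a ^ suc n + 1 ≤ suc a ^ suc n
powerPlusOne≤ a n = begin
  a * a ^ n + 1      ≡⟨ +-comm (a * a ^ n) 1 ⟩
  1 + a * a ^ n      ≤⟨ +-mono-≤ (m^n>0 (suc a) n) (*-monoʳ-≤ a (^-monoˡ-≤ n (n≤1+n a))) ⟩
  suc a ^ n + a * suc a ^ n ∎
  where open ≤-Reasoning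

recurrenceBound : ∀ a k → suc (a ^ suc (suc k) + a ^ suc k) ≤ suc a ^ suc (suc k)
recurrenceBound a k = begin
  suc (a ^ suc (suc k) + a ^ suc k)   ≡⟨ cong suc (+-comm (a ^ suc (suc k)) (a ^ suc k)) ⟩
  suc (a ^ suc k + a ^ suc (suc k))   ≡⟨ cong (_+ a ^ suc (suc k)) (+-comm 1 (a ^ suc k)) ⟩
  (a ^ suc k + 1) + a * a ^ suc k
    ≤⟨ +-mono-≤ (powerPlusOne≤ a k) (*-monoʳ-≤ a (^-monoˡ-≤ (suc k) (n≤1+n a))) ⟩
  suc a ^ suc k + a * suc a ^ suc k   ∎
  where open ≤-Reasoning

sizeBound : ∀ k h T → RightChainFree (suc k) T → height T ≤ h → size T ≤ h ^ suc k
leftSizeBound : ∀ k h l r → RightChainFree (suc k) (node l r) →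
  mheight l ≤ h → msize l ≤ h ^ suc k
rightSizeBound : ∀ k h l r → RightChainFree (suc (suc k)) (node l r) →
  mheight r ≤ h → msize r ≤ h ^ suc k

sizeBound zero    h       T          free _ = contradiction free (notOneFree T)
sizeBound (suc k) zero    (node l r) _ ()
sizeBound (suc k) (suc h) (node l r) free (s≤s height≤h) = begin
  suc (msize l + msize r)
    ≤⟨ s≤s (+-mono-≤ (leftSizeBound (suc k) h l r free (m⊔n≤o⇒m≤o _ _ height≤h))
                     (rightSizeBound k h l r free (m⊔n≤o⇒n≤o _ _ height≤h))) ⟩
  suc (h ^ suc (suc k) + h ^ suc k) ≤⟨ recurrenceBound h k ⟩
  suc h ^ suc (suc k) ∎
  where open ≤-Reasoning

leftSizeBound k h nothing  r _ _        = z≤n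
leftSizeBound k h (just l) r free height≤h = sizeBound k h l (leftFree free) height≤h

rightSizeBound k h l nothing  _ _        = z≤n
rightSizeBound k h l (just r) free height≤h = sizeBound k h r (rightFree free) height≤h

-- Theorem 9.  The bound h^t from sizeBound is weakened to h^(t+1); h ≥ 1
-- because every tree has height at least 1.
mainTheorem9 : (T : BTree) (t h : ℕ) → 1 ≤ t →
    (∀ p → IsLeaf T p → ¬ HasRightChain t p) →
    height T ≤ h → size T ≤ h ^ suc t
mainTheorem9 (node l r) (suc k) zero    _ _ ()
mainTheorem9 (node l r) (suc k) (suc h) _ free height≤h = begin
  size (node l r)     ≤⟨ sizeBound k (suc h) (node l r) free height≤h ⟩
  suc h ^ suc k       ≤⟨ ^-monoʳ-≤ (suc h) (n≤1+n (suc k)) ⟩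
  suc h ^ suc (suc k) ∎
  where open ≤-Reasoning
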